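{- Let $M\models T$ (described below), in the language $L_C$, and let $\Phi(x,\bar y)$ be a quantifier-free equivalence formula. Then $\exists x\,\Phi(x,\bar y)$ is equivalent in $M$ to a quantifier-free $L_C$-formula $\theta(\bar y)$.
   Context: $E$ is a binary relation and $f,g$ unary functions; for $s = s_1\cdots s_n\in\{f,g\}^n$, $s(x)$ denotes $s_1(s_2(\cdots s_n(x)\cdots))$. $T_0$: (a) $E$ is an equivalence relation; (b) $xEy \to f(x)Eg(y)$; (c) there is a single class $C_{fin} = \{x: f(x)=x\}=\{x:g(x)=x\}$; (d) there is a single class $C_{init} = \{x:\text{no } z \text{ has } f(z)=x\} = \{x:\text{no } z\text{ has } g(z)=x\}$; (e) $x,y\notin C_{fin}$ and $f(x)Ef(y)$ imply $xEy$; (f) for each class $C\ne C_{init}$ and $(x,y)\in C^2$ there is a unique $z$ (unique $z\notin C_{fin}$ if $C=C_{fin}$) with $f(z)=x$, $g(z)=y$. $T = T_0$ plus (g) for $k\ge1$, $x\notin C_{fin}\to\neg(f^k(x)Ex)$; (h) infinitely many classes; (i) all classes infinite. $L_C$ expands $\{E,f,g\}$ by unary predicates $C_{init+k}$ ($=f^k(C_{init})$) and $C_{fin-k}$ ($C_{fin-0}=C_{fin}$, $C_{fin-k} = f^{ -k}(C_{fin})\setminus f^{ -(k-1)}(C_{fin})$ for $k\ge1$). An equivalence formula is an $L_C$-formula not using the equality symbol. -}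

module Defs where

open import Data.Nat using (ℕ; zero; suc)
open import Data.Fin using (Fin; zero; suc)
open import Data.Product using (Σ; _×_; _,_; ∃)
open import Data.Unit using (⊤)
open import Data.Empty using (⊥)
open import Data.Sum using (_⊎_)
open import Data.Vec.Functional using (_∷_)
open import Relation.Nullary using (¬_)
open import Relation.Binary.PropositionalEquality using (_≡_; _≢_)
open import Function.Bundles using (_⇔_)

iter : {A : Set} → (A → A) → ℕ → A → A
iter h zero x = x
iter h (suc k) x = h (iter h k x)

record Str : Set₁ where
  field
    A : Set
    E : A → A → Set
    f : A → A
    g : A → A

  Cfin : A → Set
  Cfin x = f x ≡ x

  CfinG : A → Set
  CfinG x = g x ≡ x

  Cinit : A → Set
  Cinit x = ∀ z → f z ≢ x

  CinitG : A → Set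
  CinitG x = ∀ z → g z ≢ x

  IsClass : (A → Set) → Set
  IsClass P = Σ A P × (∀ x y → P x → (P y ⇔ E x y))

  SameSet : (A → Set) → (A → Set) → Set
  SameSet P Q = ∀ x → P x ⇔ Q x

  ∃! : (A → Set) → Set
  ∃! P = Σ A λ z → P z × (∀ z' → P z' → z' ≡ z)

  CinitPlus : ℕ → A → Set
  CinitPlus k x = Σ A λ z → Cinit z × iter f k z ≡ x

  CfinMinus : ℕ → A → Set
  CfinMinus zero x = Cfin x
  CfinMinus (suc k) x = Cfin (iter f (suc k) x) × ¬ Cfin (iter f k x)

record IsModelT (M : Str) : Set where
  open Str M
  field
    E-refl  : ∀ x → E x x
    E-sym   : ∀ x y → E x y → E y x
    E-trans : ∀ x y z → E x y → E y z → E x z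
    ax-b : ∀ x y → E x y → E (f x) (g y)
    ax-c-class : IsClass Cfin
    ax-c-eq    : SameSet Cfin CfinG
    ax-d-class : IsClass Cinit
    ax-d-eq    : SameSet Cinit CinitG
    ax-e : ∀ x y → ¬ Cfin x → ¬ Cfin y → E (f x) (f y) → E x y
    ax-f-fin    : ∀ x y → ¬ Cinit x → E x y → Cfin x →
                  ∃! (λ z → ¬ Cfin z × f z ≡ x × g z ≡ y)
    ax-f-notfin : ∀ x y → ¬ Cinit x → E x y → ¬ Cfin x →
                  ∃! (λ z → f z ≡ x × g z ≡ y)
    ax-g : ∀ k x → ¬ Cfin x → ¬ E (iter f (suc k) x) x
    ax-h : ∀ n → Σ (Fin n → A) λ v → ∀ i j → i ≢ j → ¬ E (v i) (v j)
    ax-i : ∀ a n → Σ (Fin n → A) λ v →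
             (∀ i j → i ≢ j → v i ≢ v j) × (∀ i → E a (v i))

data Term (n : ℕ) : Set where
  var : Fin n → Term n
  fT  : Term n → Term n
  gT  : Term n → Term n

data QF (n : ℕ) : Set where
  tt    : QF n
  ff    : QF n
  atE   : Term n → Term n → QF n
  atEq  : Term n → Term n → QF n
  atCinitPlus : ℕ → Term n → QF n
  atCfinMinus : ℕ → Term n → QF n
  neg   : QF n → QF n
  and   : QF n → QF n → QF n
  or    : QF n → QF n → QF n

-- equivalence formulas: no use of the equality symbol
data EqFree {n : ℕ} : QF n → Set where
  tt    : EqFree tt
  ff    : EqFree ff
  atE   : ∀ s t → EqFree (atE s t)
  atCinitPlus : ∀ k t → EqFree (atCinitPlus k t)
  atCfinMinus : ∀ k t → EqFree (atCfinMinus k t)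
  neg   : ∀ {φ} → EqFree φ → EqFree (neg φ)
  and   : ∀ {φ ψ} → EqFree φ → EqFree ψ → EqFree (and φ ψ)
  or    : ∀ {φ ψ} → EqFree φ → EqFree ψ → EqFree (or φ ψ)

module _ (M : Str) where
  open Str M

  evalT : ∀ {n} → (Fin n → A) → Term n → A
  evalT ρ (var i) = ρ i
  evalT ρ (fT t) = f (evalT ρ t)
  evalT ρ (gT t) = g (evalT ρ t)

  Sat : ∀ {n} → (Fin n → A) → QF n → Set
  Sat ρ tt = ⊤
  Sat ρ ff = ⊥
  Sat ρ (atE s t) = E (evalT ρ s) (evalT ρ t)
  Sat ρ (atEq s t) = evalT ρ s ≡ evalT ρ t
  Sat ρ (atCinitPlus k t) = CinitPlus k (evalT ρ t)
  Sat ρ (atCfinMinus k t) = CfinMinus k (evalT ρ t)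
  Sat ρ (neg φ) = ¬ Sat ρ φ
  Sat ρ (and φ ψ) = Sat ρ φ × Sat ρ ψ
  Sat ρ (or φ ψ) = Sat ρ φ ⊎ Sat ρ ψ

  -- M ⊨ ∃x Φ(x,ȳ) ; x is variable 0, ȳ are variables 1..n
  SatEx : ∀ {n} → (Fin n → A) → QF (suc n) → Set
  SatEx ρ Φ = Σ A λ a → Sat (a ∷ ρ) Φ

-- Let K be the depth of Φ. With excluded middle, a property of ȳ that depends only on which of
-- finitely many quantifier-free formulas hold of ȳ is defined by a decision tree over them. So it
-- suffices that ∃x Φ(x, ȳ) depends only on the atomic facts E(f^c y_i, f^d y_j), C_init+k(f^c y_i)
-- and C_fin-k(f^c y_i) with c, d, k ≤ 3K; every term is E-equivalent to some f^c y_i, as g x E f x.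
-- Given ȳ, ȳ' agreeing on these facts and any x, one finds x' such that (x, ȳ) and (x', ȳ') agree on
-- such facts up to depth K, which no equivalence formula of depth K can distinguish:
--   * x in some C_fin-m or C_init+j (m, j ≤ 2K): x' = x, as the class of f^c x is named by an atom;
--   * x E f^e(y_i): x' = f^e(y'_i);
--   * f^a(x) E y_i with 1 ≤ a ≤ K: x' an a-fold f-preimage of y'_i, which exists by axiom (f);
--   * otherwise x is generic over ȳ, and by axiom (h) and pigeonhole some x' avoids the finitely
--     many classes that would make it non-generic over ȳ'.
-- Axioms (e) and (g) (f^c is injective up to E off C_fin, and f has no E-cycles) make the atomic
-- facts about such pulled-back or generic elements the same for x and x'.
module Submission where

open import Defs
open import Axiom.ExcludedMiddle using (ExcludedMiddle)
open import Level using (0ℓ)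
open import Data.Nat using (ℕ; zero; suc; pred; _+_; _∸_; _⊔_; _*_; _≤_; _<_; z≤n; s≤s)
open import Data.Nat.Properties
open import Data.Fin using (Fin; toℕ; fromℕ<) renaming (_<_ to _<ᶠ_)
import Data.Fin.Properties as Finₚ
open import Data.Fin.Properties using (pigeonhole; +↔⊎; *↔×; toℕ<n; toℕ≤pred[n]; toℕ-fromℕ<)
open import Data.List using (List; []; _∷_; _++_; map; allFin; upTo; cartesianProduct)
open import Data.List.Membership.Propositional using (_∈_)
open import Data.List.Membership.Propositional.Properties
  using (∈-map⁺; ∈-++⁺ˡ; ∈-++⁺ʳ; ∈-allFin; ∈-upTo⁺; ∈-cartesianProduct⁺)
open import Data.List.Relation.Unary.Any using (here; there)
open import Data.Product using (Σ; ∃; ∃₂; _×_; _,_; proj₁; proj₂)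
open import Data.Product.Function.NonDependent.Propositional using (_×-⇔_)
open import Data.Sum using (_⊎_; inj₁; inj₂)
open import Data.Sum.Function.Propositional using (_⊎-⇔_; _⊎-↔_)
open import Data.Empty using (⊥-elim)
open import Data.Vec.Functional using () renaming (_∷_ to _∷ᵛ_)
open import Relation.Nullary using (¬_; Dec; yes; no)
open import Relation.Binary.Structures using (IsEquivalence)
open import Relation.Binary.PropositionalEquality using (_≡_; refl; sym; trans; cong; cong₂; subst; subst₂)
open import Function.Base using (_∘_)
open import Function.Bundles using (_⇔_; mk⇔; Equivalence; _↔_; _↣_; Injection)
open import Function.Properties.Inverse using (↔⇒↣; ↔-sym)
open import Function.Construct.Composition using (_↔-∘_)
open import Function.Related.TypeIsomorphisms using (¬-cong-⇔)
import Function.Properties.Equivalence as ⇔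

open Equivalence using (to; from)

⇔-via : {P P' Q Q' : Set} → P ⇔ P' → P' ⇔ Q' → Q ⇔ Q' → P ⇔ Q
⇔-via p b q = ⇔.trans p (⇔.trans b (⇔.sym q))

false⇔false : {P Q : Set} → ¬ P → ¬ Q → P ⇔ Q
false⇔false ¬p ¬q = mk⇔ (⊥-elim ∘ ¬p) (⊥-elim ∘ ¬q)

data Order : ℕ → ℕ → Set where
  below : ∀ c r → Order c (c + r)
  above : ∀ d r → Order (d + suc r) d

order : ∀ c d → Order c d
order zero d = below zero d
order (suc c) zero = above zero c
order (suc c) (suc d) with order c d
... | below c r = below (suc c) r
... | above d r = above (suc d) r

at-fromℕ< : (P : ℕ → Set) {r m : ℕ} (r<m : r < m) → P r → P (toℕ (fromℕ< r<m))
at-fromℕ< P r<m = subst P (sym (toℕ-fromℕ< r<m))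

iter-+ : {A : Set} (h : A → A) (c d : ℕ) (x : A) → iter h (c + d) x ≡ iter h c (iter h d x)
iter-+ h zero d x = refl
iter-+ h (suc c) d x = cong h (iter-+ h c d x)

iter-+′ : {A : Set} (h : A → A) (c d : ℕ) (x : A) → iter h (c + d) x ≡ iter h d (iter h c x)
iter-+′ h c d x = trans (cong (λ k → iter h k x) (+-comm c d)) (iter-+ h d c x)

iter-split : {A : Set} (h : A → A) {c d : ℕ} (x : A) → c ≤ d → iter h d x ≡ iter h (d ∸ c) (iter h c x)
iter-split h {c} {d} x c≤d = trans (cong (λ k → iter h k x) (sym (m∸n+n≡m c≤d))) (iter-+ h (d ∸ c) c x)

depth : ∀ {m} → Term m → ℕ
depth (var i) = zero
depth (fT t) = suc (depth t)
depth (gT t) = suc (depth t)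

root : ∀ {m} → Term m → Fin m
root (var i) = i
root (fT t) = root t
root (gT t) = root t

bound : ∀ {m} → QF m → ℕ
bound tt = zero
bound ff = zero
bound (atE s t) = depth s ⊔ depth t
bound (atEq s t) = depth s ⊔ depth t
bound (atCinitPlus k t) = k ⊔ depth t
bound (atCfinMinus k t) = k ⊔ depth t
bound (neg φ) = bound φ
bound (and φ ψ) = bound φ ⊔ bound ψ
bound (or φ ψ) = bound φ ⊔ bound ψ

module Definability (M : Str) (n : ℕ) where
  open Str M using (A)

  Agree : List (QF n) → (Fin n → A) → (Fin n → A) → Set
  Agree L ȳ ȳ' = ∀ {α} → α ∈ L → Sat M ȳ α ⇔ Sat M ȳ' α

  Invariant : List (QF n) → ((Fin n → A) → Set) → Set
  Invariant L Q = ∀ {ȳ ȳ'} → Agree L ȳ ȳ' → Q ȳ → Q ȳ'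

  Saturation : List (QF n) → ((Fin n → A) → Set) → (Fin n → A) → Set
  Saturation L Q ȳ = Σ (Fin n → A) λ ȳ₀ → Agree L ȳ₀ ȳ × Q ȳ₀

  saturation-invariant : ∀ L Q → Invariant L (Saturation L Q)
  saturation-invariant L Q ag (ȳ₀ , ag₀ , q) = ȳ₀ , (λ α∈L → ⇔.trans (ag₀ α∈L) (ag α∈L)) , q

  module _ (lem : ExcludedMiddle 0ℓ) where
    truthValue : {P : Set} → Dec P → QF n
    truthValue (yes _) = tt
    truthValue (no _) = ff

    decisionTree : List (QF n) → ((Fin n → A) → Set) → QF n
    decisionTree [] Q = truthValue (lem {∃ Q})
    decisionTree (α ∷ L) Q =
      or (and α       (decisionTree L (Saturation L λ ȳ → Sat M ȳ α × Q ȳ)))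
         (and (neg α) (decisionTree L (Saturation L λ ȳ → ¬ Sat M ȳ α × Q ȳ)))

    decisionTree-correct : ∀ L Q → Invariant L Q → ∀ ȳ → Q ȳ ⇔ Sat M ȳ (decisionTree L Q)
    decisionTree-correct [] Q inv ȳ = constant (lem {∃ Q})
      where
      constant : (d : Dec (∃ Q)) → Q ȳ ⇔ Sat M ȳ (truthValue d)
      constant (yes (ȳ₀ , q)) = mk⇔ _ (λ _ → inv (λ ()) q)
      constant (no ¬q) = mk⇔ (λ q → ¬q (ȳ , q)) λ ()
    decisionTree-correct (α ∷ L) Q inv ȳ = mk⇔ decide recover
      where
      Q⁺ Q⁻ : (Fin n → A) → Set
      Q⁺ = Saturation L λ ȳ → Sat M ȳ α × Q ȳ
      Q⁻ = Saturation L λ ȳ → ¬ Sat M ȳ α × Q ȳ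

      IH⁺ : Q⁺ ȳ ⇔ Sat M ȳ (decisionTree L Q⁺)
      IH⁺ = decisionTree-correct L Q⁺ (saturation-invariant L _) ȳ
      IH⁻ : Q⁻ ȳ ⇔ Sat M ȳ (decisionTree L Q⁻)
      IH⁻ = decisionTree-correct L Q⁻ (saturation-invariant L _) ȳ

      agree-∷ : ∀ {ȳ₀} → (Sat M ȳ₀ α ⇔ Sat M ȳ α) → Agree L ȳ₀ ȳ → Agree (α ∷ L) ȳ₀ ȳ
      agree-∷ eα ag (here refl) = eα
      agree-∷ eα ag (there β∈L) = ag β∈L

      decide : Q ȳ → Sat M ȳ (decisionTree (α ∷ L) Q)
      decide q with lem {Sat M ȳ α}
      ... | yes s = inj₁ (s , to IH⁺ (ȳ , (λ _ → ⇔.refl) , s , q))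
      ... | no ¬s = inj₂ (¬s , to IH⁻ (ȳ , (λ _ → ⇔.refl) , ¬s , q))

      recover : Sat M ȳ (decisionTree (α ∷ L) Q) → Q ȳ
      recover (inj₁ (s , t)) with from IH⁺ t
      ... | ȳ₀ , ag , s₀ , q₀ = inv (agree-∷ (mk⇔ (λ _ → s) (λ _ → s₀)) ag) q₀
      recover (inj₂ (¬s , t)) with from IH⁻ t
      ... | ȳ₀ , ag , ¬s₀ , q₀ = inv (agree-∷ (false⇔false ¬s₀ ¬s) ag) q₀

module Similarity (M : Str) where
  open Str M

  f^ : ℕ → A → A
  f^ = iter f

  record Similar (K : ℕ) {m : ℕ} (ρ ρ' : Fin m → A) : Set where
    field
      E-similar    : ∀ i j c d → c ≤ K → d ≤ K →
                     E (f^ c (ρ i)) (f^ d (ρ j)) ⇔ E (f^ c (ρ' i)) (f^ d (ρ' j))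
      init-similar : ∀ i c k → c ≤ K → k ≤ K → CinitPlus k (f^ c (ρ i)) ⇔ CinitPlus k (f^ c (ρ' i))
      fin-similar  : ∀ i c k → c ≤ K → k ≤ K → CfinMinus k (f^ c (ρ i)) ⇔ CfinMinus k (f^ c (ρ' i))

  Similar-refl : ∀ {K m} {ρ : Fin m → A} → Similar K ρ ρ
  Similar-refl = record
    { E-similar = λ _ _ _ _ _ _ → ⇔.refl
    ; init-similar = λ _ _ _ _ _ → ⇔.refl
    ; fin-similar = λ _ _ _ _ _ → ⇔.refl
    }

  Similar-mono : ∀ {K K' m} {ρ ρ' : Fin m → A} → K ≤ K' → Similar K' ρ ρ' → Similar K ρ ρ'
  Similar-mono K≤K' sim = record
    { E-similar = λ i j c d c≤ d≤ → E-similar i j c d (≤-trans c≤ K≤K') (≤-trans d≤ K≤K')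
    ; init-similar = λ i c k c≤ k≤ → init-similar i c k (≤-trans c≤ K≤K') (≤-trans k≤ K≤K')
    ; fin-similar = λ i c k c≤ k≤ → fin-similar i c k (≤-trans c≤ K≤K') (≤-trans k≤ K≤K')
    }
    where open Similar sim

  iterTerm : ∀ {n} → Fin n × ℕ → Term n
  iterTerm (i , c) = iter fT c (var i)

  evalT-iterTerm : ∀ {n} (ρ : Fin n → A) i c → evalT M ρ (iterTerm (i , c)) ≡ f^ c (ρ i)
  evalT-iterTerm ρ i zero = refl
  evalT-iterTerm ρ i (suc c) = cong f (evalT-iterTerm ρ i c)

  E-atom : ∀ {n} → (Fin n × ℕ) × (Fin n × ℕ) → QF n
  E-atom (p , q) = atE (iterTerm p) (iterTerm q)

  init-atom fin-atom : ∀ {n} → (Fin n × ℕ) × ℕ → QF n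
  init-atom (p , k) = atCinitPlus k (iterTerm p)
  fin-atom (p , k) = atCfinMinus k (iterTerm p)

  points : (n B : ℕ) → List (Fin n × ℕ)
  points n B = cartesianProduct (allFin n) (upTo (suc B))

  E-atoms init-atoms fin-atoms atoms : (n B : ℕ) → List (QF n)
  E-atoms n B = map E-atom (cartesianProduct (points n B) (points n B))
  init-atoms n B = map init-atom (cartesianProduct (points n B) (upTo (suc B)))
  fin-atoms n B = map fin-atom (cartesianProduct (points n B) (upTo (suc B)))
  atoms n B = E-atoms n B ++ init-atoms n B ++ fin-atoms n B

  open Definability M using (Agree)

  agree⇒similar : ∀ {n B} {ȳ ȳ' : Fin n → A} → Agree n (atoms n B) ȳ ȳ' → Similar B ȳ ȳ'
  agree⇒similar {n} {B} {ȳ} {ȳ'} agree = record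
    { E-similar = λ i j c d c≤ d≤ →
        subst₂ _⇔_ (Sat-E-atom ȳ i c j d) (Sat-E-atom ȳ' i c j d)
          (agree (∈-++⁺ˡ (∈-map⁺ E-atom (∈-cartesianProduct⁺ (point∈ i c≤) (point∈ j d≤)))))
    ; init-similar = λ i c k c≤ k≤ →
        subst₂ _⇔_ (cong (CinitPlus k) (evalT-iterTerm ȳ i c)) (cong (CinitPlus k) (evalT-iterTerm ȳ' i c))
          (agree (∈-++⁺ʳ (E-atoms n B) (∈-++⁺ˡ (∈-map⁺ init-atom (indexed∈ i c≤ k≤)))))
    ; fin-similar = λ i c k c≤ k≤ →
        subst₂ _⇔_ (cong (CfinMinus k) (evalT-iterTerm ȳ i c)) (cong (CfinMinus k) (evalT-iterTerm ȳ' i c))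
          (agree (∈-++⁺ʳ (E-atoms n B) (∈-++⁺ʳ (init-atoms n B) (∈-map⁺ fin-atom (indexed∈ i c≤ k≤)))))
    }
    where
    point∈ : ∀ i {c} → c ≤ B → (i , c) ∈ points n B
    point∈ i c≤ = ∈-cartesianProduct⁺ (∈-allFin i) (∈-upTo⁺ (s≤s c≤))

    indexed∈ : ∀ i {c k} → c ≤ B → k ≤ B → ((i , c) , k) ∈ cartesianProduct (points n B) (upTo (suc B))
    indexed∈ i c≤ k≤ = ∈-cartesianProduct⁺ (point∈ i c≤) (∈-upTo⁺ (s≤s k≤))

    Sat-E-atom : ∀ (ρ : Fin n → A) i c j d → Sat M ρ (E-atom ((i , c) , (j , d))) ≡ E (f^ c (ρ i)) (f^ d (ρ j))
    Sat-E-atom ρ i c j d = cong₂ E (evalT-iterTerm ρ i c) (evalT-iterTerm ρ j d)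

module Model (lem : ExcludedMiddle 0ℓ) (M : Str) (mod : IsModelT M) where
  open Str M
  open IsModelT mod hiding (E-refl; E-sym; E-trans)
  open Similarity M

  E-isEquivalence : IsEquivalence E
  E-isEquivalence = record
    { refl = IsModelT.E-refl mod _
    ; sym = IsModelT.E-sym mod _ _
    ; trans = IsModelT.E-trans mod _ _ _
    }

  open IsEquivalence E-isEquivalence
    using () renaming (refl to E-refl; sym to E-sym; trans to E-trans; reflexive to E-reflexive)

  E-cong : ∀ {x x' y y'} → E x x' → E y y' → E x y ⇔ E x' y'
  E-cong p q = mk⇔ (λ e → E-trans (E-sym p) (E-trans e q)) (λ e → E-trans p (E-trans e (E-sym q)))

  E-f : ∀ {x y} → E x y → E (f x) (f y)
  E-f {x} {y} e = E-trans (ax-b x y e) (E-sym (ax-b y y E-refl))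

  E-iter : ∀ k {x y} → E x y → E (f^ k x) (f^ k y)
  E-iter zero e = e
  E-iter (suc k) e = E-f (E-iter k e)

  g-E-f : ∀ x → E (g x) (f x)
  g-E-f x = E-sym (ax-b x x E-refl)

  Cfin-resp : ∀ {x y} → Cfin x → E x y → Cfin y
  Cfin-resp {x} {y} p = from (proj₂ ax-c-class x y p)

  Cfin-E : ∀ {x y} → Cfin x → Cfin y → E x y
  Cfin-E {x} {y} p = to (proj₂ ax-c-class x y p)

  Cinit-resp : ∀ {x y} → Cinit x → E x y → Cinit y
  Cinit-resp {x} {y} p = from (proj₂ ax-d-class x y p)

  Cinit-E : ∀ {x y} → Cinit x → Cinit y → E x y
  Cinit-E {x} {y} p = to (proj₂ ax-d-class x y p)

  Cfin-iter : ∀ k {x} → Cfin x → Cfin (f^ k x)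
  Cfin-iter zero p = p
  Cfin-iter (suc k) p = cong f (Cfin-iter k p)

  ¬Cfin-≤ : ∀ {c d x} → c ≤ d → ¬ Cfin (f^ d x) → ¬ Cfin (f^ c x)
  ¬Cfin-≤ {c} {d} {x} c≤d ¬p p = ¬p (subst Cfin (sym (iter-split f x c≤d)) (Cfin-iter (d ∸ c) p))

  ¬Cinit-f : ∀ x → ¬ Cinit (f x)
  ¬Cinit-f x p = p x refl

  E-cancel-iter : ∀ k {u t} → ¬ Cfin (f^ k u) → E (f^ k u) (f^ k t) → E u t
  E-cancel-iter zero ¬p e = e
  E-cancel-iter (suc k) {u} {t} ¬p e = E-cancel-iter k ¬pu (ax-e _ _ ¬pu ¬pt e)
    where
    ¬pu : ¬ Cfin (f^ k u)
    ¬pu p = ¬p (cong f p)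
    ¬pt : ¬ Cfin (f^ k t)
    ¬pt p = ¬p (Cfin-resp (cong f p) (E-sym e))

  E-iter-self : ∀ {u} c d → ¬ Cfin (f^ c u) → ¬ Cfin (f^ d u) → E (f^ c u) (f^ d u) ⇔ c ≡ d
  E-iter-self {u} c d ¬pc ¬pd = mk⇔ (injective c d ¬pc ¬pd) λ { refl → E-refl }
    where
    injective : ∀ c d → ¬ Cfin (f^ c u) → ¬ Cfin (f^ d u) → E (f^ c u) (f^ d u) → c ≡ d
    injective c d ¬pc ¬pd e with order c d
    ... | below c zero = sym (+-identityʳ c)
    ... | below c (suc s) = ⊥-elim (ax-g s (f^ c u) ¬pc (E-sym (E-trans e (E-reflexive (iter-+′ f c (suc s) u)))))
    ... | above d s = ⊥-elim (ax-g s (f^ d u) ¬pd (E-trans (E-reflexive (sym (iter-+′ f d (suc s) u))) e))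

  preimage : ∀ {y} → ¬ Cinit y → Σ A λ w → ¬ Cfin w × f w ≡ y
  preimage {y} ¬init with lem {Cfin y}
  ... | yes fin with ax-f-fin y y ¬init E-refl fin
  ...   | w , (¬fin , fw≡y , _) , _ = w , ¬fin , fw≡y
  preimage {y} ¬init | no ¬fin with ax-f-notfin y y ¬init E-refl ¬fin
  ...   | w , (fw≡y , _) , _ = w , (λ p → ¬fin (subst Cfin fw≡y (cong f p))) , fw≡y

  CinitPlus-from : ∀ k {z y} → Cinit z → E (f^ k z) y → CinitPlus k y
  CinitPlus-from zero init e = _ , Cinit-resp init e , refl
  CinitPlus-from (suc k) {z} {y} init e with lem {Cfin (f^ k z)}
  ... | yes fin with CinitPlus-from k init (E-trans (E-reflexive (sym fin)) e)
  ...   | z' , init' , refl = z' , init' , Cfin-resp (cong f fin) e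
  CinitPlus-from (suc k) {z} {y} init e | no ¬fin
    with preimage {y} (λ p → ¬Cinit-f (f^ k z) (Cinit-resp p (E-sym e)))
  ... | w , ¬fin-w , fw≡y
    with CinitPlus-from k init (E-sym (ax-e w _ ¬fin-w ¬fin (E-trans (E-reflexive fw≡y) (E-sym e))))
  ...   | z' , init' , eq = z' , init' , trans (cong f eq) fw≡y

  CinitPlus-resp : ∀ k {x y} → CinitPlus k x → E x y → CinitPlus k y
  CinitPlus-resp k (z , init , eq) e = CinitPlus-from k init (E-trans (E-reflexive eq) e)

  CinitPlus-E : ∀ k {x y} → CinitPlus k x → CinitPlus k y → E x y
  CinitPlus-E k (z , init , refl) (z' , init' , refl) = E-iter k (Cinit-E init init')

  CinitPlus-cong : ∀ k {x y} → E x y → CinitPlus k x ⇔ CinitPlus k y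
  CinitPlus-cong k e = mk⇔ (λ p → CinitPlus-resp k p e) (λ p → CinitPlus-resp k p (E-sym e))

  E⇔CinitPlus : ∀ k {u w} → CinitPlus k u → E u w ⇔ CinitPlus k w
  E⇔CinitPlus k p = mk⇔ (CinitPlus-resp k p) (CinitPlus-E k p)

  CinitPlus-iter : ∀ c {k x} → CinitPlus k x → CinitPlus (c + k) (f^ c x)
  CinitPlus-iter c {k} (z , init , eq) = z , init , trans (iter-+ f c k z) (cong (f^ c) eq)

  CinitPlus-cancel : ∀ c k {x} → ¬ Cfin (f^ c x) → CinitPlus k (f^ c x) → Σ ℕ λ r → k ≡ c + r × CinitPlus r x
  CinitPlus-cancel c k {x} ¬fin (z , init , eq) with order c k
  ... | below c r =
    r , refl , CinitPlus-from r init (E-sym (E-cancel-iter c ¬fin (E-reflexive (trans (sym eq) (iter-+ f c r z)))))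
  ... | above k r =
    ⊥-elim (¬Cinit-f (f^ r x)
      (Cinit-resp init (E-cancel-iter k (¬fin ∘ subst Cfin eq) (E-reflexive (trans eq (iter-+ f k (suc r) x))))))

  CfinMinus⇒Cfin : ∀ k {x} → CfinMinus k x → Cfin (f^ k x)
  CfinMinus⇒Cfin zero p = p
  CfinMinus⇒Cfin (suc k) (p , _) = p

  CfinMinus-resp : ∀ k {x y} → CfinMinus k x → E x y → CfinMinus k y
  CfinMinus-resp zero p e = Cfin-resp p e
  CfinMinus-resp (suc k) (p , ¬p) e = Cfin-resp p (E-iter (suc k) e) , λ q → ¬p (Cfin-resp q (E-sym (E-iter k e)))

  CfinMinus-E : ∀ k {x y} → CfinMinus k x → CfinMinus k y → E x y
  CfinMinus-E zero p q = Cfin-E p q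
  CfinMinus-E (suc k) (p , ¬p) (q , ¬q) = E-cancel-iter k ¬p (ax-e _ _ ¬p ¬q (Cfin-E p q))

  CfinMinus-cong : ∀ k {x y} → E x y → CfinMinus k x ⇔ CfinMinus k y
  CfinMinus-cong k e = mk⇔ (λ p → CfinMinus-resp k p e) (λ p → CfinMinus-resp k p (E-sym e))

  E⇔CfinMinus : ∀ k {u w} → CfinMinus k u → E u w ⇔ CfinMinus k w
  E⇔CfinMinus k p = mk⇔ (CfinMinus-resp k p) (CfinMinus-E k p)

  CfinMinus-f : ∀ k {x} → CfinMinus k x → CfinMinus (pred k) (f x)
  CfinMinus-f zero p = cong f p
  CfinMinus-f (suc zero) (p , _) = p
  CfinMinus-f (suc (suc k)) {x} (p , ¬p) =
    subst Cfin (iter-+′ f 1 (suc k) x) p , ¬p ∘ subst Cfin (sym (iter-+′ f 1 k x))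

  CfinMinus-iter : ∀ k c {x} → CfinMinus k x → CfinMinus (k ∸ c) (f^ c x)
  CfinMinus-iter k zero p = p
  CfinMinus-iter k (suc c) {x} p =
    subst (λ m → CfinMinus m (f^ (suc c) x)) (pred[m∸n]≡m∸[1+n] k c) (CfinMinus-f (k ∸ c) (CfinMinus-iter k c p))

  ¬CfinMinus⇒¬Cfin : ∀ L {x} → (∀ m → m ≤ L → ¬ CfinMinus m x) → ¬ Cfin (f^ L x)
  ¬CfinMinus⇒¬Cfin zero none = none zero z≤n
  ¬CfinMinus⇒¬Cfin (suc L) none p =
    none (suc L) ≤-refl (p , ¬CfinMinus⇒¬Cfin L λ m m≤L → none m (m≤n⇒m≤1+n m≤L))

  E-iter-below : ∀ {u w t} c s d → ¬ Cfin (f^ (c + s) u) → E (f^ (c + s) u) w →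
                 E (f^ c u) (f^ d t) ⇔ E w (f^ (s + d) t)
  E-iter-below {u} {w} {t} c s d ¬fin p = ⇔.trans (mk⇔ shift unshift) (E-cong p E-refl)
    where
    shift : E (f^ c u) (f^ d t) → E (f^ (c + s) u) (f^ (s + d) t)
    shift q = subst₂ E (sym (iter-+′ f c s u)) (sym (iter-+ f s d t)) (E-iter s q)
    unshift : E (f^ (c + s) u) (f^ (s + d) t) → E (f^ c u) (f^ d t)
    unshift q = E-cancel-iter s (¬fin ∘ subst Cfin (sym (iter-+′ f c s u)))
                  (subst₂ E (iter-+′ f c s u) (iter-+ f s d t) q)

  E-iter-above : ∀ {u w t} a s → E (f^ a u) w → E (f^ (a + s) u) t ⇔ E (f^ s w) t
  E-iter-above {u} a s p = E-cong (E-trans (E-reflexive (iter-+′ f a s u)) (E-iter s p)) E-refl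

  preimage-iter : ∀ a {w} → (∀ m → m < a → ¬ CinitPlus m w) → Σ A λ u → f^ a u ≡ w
  preimage-iter zero none = _ , refl
  preimage-iter (suc a) {w} none with preimage {w} (λ init → none zero (s≤s z≤n) (w , init , refl))
  ... | z , _ , fz≡w
    with preimage-iter a {z} (λ m m<a p → none (suc m) (s≤s m<a) (subst (CinitPlus (suc m)) fz≡w (CinitPlus-iter 1 {m} p)))
  ...   | u , eq = u , trans (cong f eq) fz≡w

  avoid : ∀ {I : Set} {m} → I ↣ Fin m → (P : I → A → Set) → (∀ i {v w} → P i v → P i w → E v w) →
          Σ A λ v → ∀ i → ¬ P i v
  avoid {I} {m} code P unique with ax-h (suc m)
  ... | v , apart with lem {Σ (Fin (suc m)) λ k → ∀ i → ¬ P i (v k)}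
  ...   | yes (k , ¬P) = v k , ¬P
  ...   | no ¬avoided = ⊥-elim (collision (pigeonhole (n<1+n m) (Injection.to code ∘ proj₁ ∘ witness)))
    where
    witness : ∀ k → Σ I λ i → P i (v k)
    witness k with lem {Σ I λ i → P i (v k)}
    ... | yes w = w
    ... | no ¬w = ⊥-elim (¬avoided (k , λ i p → ¬w (i , p)))

    collision : ¬ ∃₂ λ k l → k <ᶠ l × Injection.to code (proj₁ (witness k)) ≡ Injection.to code (proj₁ (witness l))
    collision (k , l , k<l , same) = apart k l (Finₚ.<⇒≢ k<l) (unique _ in-class-of-l (proj₂ (witness l)))
      where
      in-class-of-l : P (proj₁ (witness l)) (v k)
      in-class-of-l = subst (λ i → P i (v k)) (Injection.injective code same) (proj₂ (witness k))

  evalT-E : ∀ {m} (ρ : Fin m → A) t → E (evalT M ρ t) (f^ (depth t) (ρ (root t)))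
  evalT-E ρ (var i) = E-refl
  evalT-E ρ (fT t) = E-f (evalT-E ρ t)
  evalT-E ρ (gT t) = E-trans (g-E-f _) (E-f (evalT-E ρ t))

  similar-Sat : ∀ {K m} {ρ ρ' : Fin m → A} → Similar K ρ ρ' →
                ∀ {φ} → EqFree φ → bound φ ≤ K → Sat M ρ φ ⇔ Sat M ρ' φ
  similar-Sat sim tt _ = ⇔.refl
  similar-Sat sim ff _ = ⇔.refl
  similar-Sat {ρ = ρ} {ρ'} sim (atE s t) b =
    ⇔-via (E-cong (evalT-E ρ s) (evalT-E ρ t))
          (Similar.E-similar sim (root s) (root t) (depth s) (depth t) (m⊔n≤o⇒m≤o _ _ b) (m⊔n≤o⇒n≤o _ _ b))
          (E-cong (evalT-E ρ' s) (evalT-E ρ' t))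
  similar-Sat {ρ = ρ} {ρ'} sim (atCinitPlus k t) b =
    ⇔-via (CinitPlus-cong k (evalT-E ρ t))
          (Similar.init-similar sim (root t) (depth t) k (m⊔n≤o⇒n≤o _ _ b) (m⊔n≤o⇒m≤o _ _ b))
          (CinitPlus-cong k (evalT-E ρ' t))
  similar-Sat {ρ = ρ} {ρ'} sim (atCfinMinus k t) b =
    ⇔-via (CfinMinus-cong k (evalT-E ρ t))
          (Similar.fin-similar sim (root t) (depth t) k (m⊔n≤o⇒n≤o _ _ b) (m⊔n≤o⇒m≤o _ _ b))
          (CfinMinus-cong k (evalT-E ρ' t))
  similar-Sat sim (neg φ) b = ¬-cong-⇔ (similar-Sat sim φ b)
  similar-Sat sim (and φ ψ) b =
    similar-Sat sim φ (m⊔n≤o⇒m≤o _ _ b) ×-⇔ similar-Sat sim ψ (m⊔n≤o⇒n≤o _ _ b)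
  similar-Sat sim (or φ ψ) b =
    similar-Sat sim φ (m⊔n≤o⇒m≤o _ _ b) ⊎-⇔ similar-Sat sim ψ (m⊔n≤o⇒n≤o _ _ b)

  module Extension (n K : ℕ) where
    -- Facts about x at depth K involve ȳ at depth up to 3K: x ∈ C_init+j with j ≤ 2K gives
    -- f^c x ∈ C_init+(c+j).
    K₂ K₃ : ℕ
    K₂ = K + K
    K₃ = K + K₂

    K≤K₂ : K ≤ K₂
    K≤K₂ = m≤m+n K K

    K₂≤K₃ : K₂ ≤ K₃
    K₂≤K₃ = m≤n+m K₂ K

    K≤K₃ : K ≤ K₃
    K≤K₃ = ≤-trans K≤K₂ K₂≤K₃

    record Free (x : A) : Set where
      field
        no-fin  : ¬ Cfin (f^ K₂ x)
        no-init : ∀ j → j ≤ K₂ → ¬ CinitPlus j x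

    Free-¬Cfin : ∀ {x c} → Free x → c ≤ K₂ → ¬ Cfin (f^ c x)
    Free-¬Cfin free c≤ = ¬Cfin-≤ c≤ (Free.no-fin free)

    Free-¬CinitPlus : ∀ {x c k} → Free x → c ≤ K₂ → k ≤ K₂ → ¬ CinitPlus k (f^ c x)
    Free-¬CinitPlus {c = c} {k} free c≤ k≤ p with CinitPlus-cancel c k (Free-¬Cfin free c≤) p
    ... | r , refl , q = Free.no-init free r (≤-trans (m≤n+m r c) k≤) q

    Free-¬CfinMinus : ∀ {x c k} → Free x → c ≤ K → k ≤ K → ¬ CfinMinus k (f^ c x)
    Free-¬CfinMinus {x} {c} {k} free c≤ k≤ p =
      Free-¬Cfin free (+-mono-≤ k≤ c≤) (subst Cfin (sym (iter-+ f k c x)) (CfinMinus⇒Cfin k p))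

    free-similar : ∀ {x x'} → Free x → Free x' → Similar K {1} (λ _ → x) (λ _ → x')
    free-similar free free' = record
      { E-similar = λ _ _ c d c≤ d≤ →
          ⇔-via (E-iter-self c d (¬fin free c≤) (¬fin free d≤)) ⇔.refl (E-iter-self c d (¬fin free' c≤) (¬fin free' d≤))
      ; init-similar = λ _ c k c≤ k≤ →
          false⇔false (Free-¬CinitPlus free (wk c≤) (wk k≤)) (Free-¬CinitPlus free' (wk c≤) (wk k≤))
      ; fin-similar = λ _ c k c≤ k≤ → false⇔false (Free-¬CfinMinus free c≤ k≤) (Free-¬CfinMinus free' c≤ k≤)
      }
      where
      wk : ∀ {c} → c ≤ K → c ≤ K₂
      wk c≤ = ≤-trans c≤ K≤K₂
      ¬fin : ∀ {x c} → Free x → c ≤ K → ¬ Cfin (f^ c x)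
      ¬fin free c≤ = Free-¬Cfin free (wk c≤)

    AnchorIx : Set
    AnchorIx = Fin (suc K₂) ⊎ Fin (suc K₂)

    Anchor : AnchorIx → A → Set
    Anchor (inj₁ m) = CfinMinus (toℕ m)
    Anchor (inj₂ j) = CinitPlus (toℕ j)

    unanchored⇒Free : ∀ {x} → (∀ a → ¬ Anchor a x) → Free x
    unanchored⇒Free {x} ¬anchor = record
      { no-fin = ¬CfinMinus⇒¬Cfin K₂ λ m m≤ p →
          ¬anchor (inj₁ (fromℕ< (s≤s m≤))) (at-fromℕ< (λ k → CfinMinus k x) (s≤s m≤) p)
      ; no-init = λ j j≤ p →
          ¬anchor (inj₂ (fromℕ< (s≤s j≤))) (at-fromℕ< (λ k → CinitPlus k x) (s≤s j≤) p)
      }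

    LinkIx : Set
    LinkIx = Fin n × Fin (suc K) ⊎ Fin n × Fin K

    -- The ¬ Cfin conjunct makes each Link ȳ l contained in a single E-class.
    Link : (Fin n → A) → LinkIx → A → Set
    Link ȳ (inj₁ (i , e)) x = E x (f^ (toℕ e) (ȳ i))
    Link ȳ (inj₂ (i , r)) x = E (f^ (suc (toℕ r)) x) (ȳ i) × ¬ Cfin (f^ (suc (toℕ r)) x)

    unlinked⇒¬E : ∀ {ȳ x} → Free x → (∀ l → ¬ Link ȳ l x) →
                  ∀ j c d → c ≤ K → d ≤ K → ¬ E (f^ c x) (f^ d (ȳ j))
    unlinked⇒¬E {ȳ} {x} free ¬link j c d c≤ d≤ e with order c d
    ... | below c r =
      ¬link (inj₁ (j , fromℕ< (s≤s (m+n≤o⇒n≤o c d≤))))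
        (at-fromℕ< (λ k → E x (f^ k (ȳ j))) (s≤s (m+n≤o⇒n≤o c d≤))
          (E-cancel-iter c (Free-¬Cfin free (≤-trans c≤ K≤K₂)) (E-trans e (E-reflexive (iter-+ f c r (ȳ j))))))
    ... | above d r =
      ¬link (inj₂ (j , fromℕ< (m+n≤o⇒n≤o d c≤)))
        (at-fromℕ< (λ k → E (f^ (suc k) x) (ȳ j) × ¬ Cfin (f^ (suc k) x)) (m+n≤o⇒n≤o d c≤)
          (E-cancel-iter d (¬fin ∘ subst Cfin (sym split)) (E-trans (E-reflexive (sym split)) e) ,
           Free-¬Cfin free (≤-trans (m+n≤o⇒n≤o d c≤) K≤K₂)))
      where
      split : f^ (d + suc r) x ≡ f^ d (f^ (suc r) x)
      split = iter-+ f d (suc r) x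
      ¬fin : ¬ Cfin (f^ (d + suc r) x)
      ¬fin = Free-¬Cfin free (≤-trans c≤ K≤K₂)

    record Extends (ȳ ȳ' : Fin n → A) (x x' : A) : Set where
      field
        self-similar : Similar K {1} (λ _ → x) (λ _ → x')
        link-similar : ∀ j c d → c ≤ K → d ≤ K → E (f^ c x) (f^ d (ȳ j)) ⇔ E (f^ c x') (f^ d (ȳ' j))

    extend-similar : ∀ {ȳ ȳ' x x'} → Similar K ȳ ȳ' → Extends ȳ ȳ' x x' → Similar K (x ∷ᵛ ȳ) (x' ∷ᵛ ȳ')
    extend-similar sim ext = record { E-similar = E-sim ; init-similar = init-sim ; fin-similar = fin-sim }
      where
      open Extends ext
      E-sym⇔ : ∀ {a b} → E a b ⇔ E b a
      E-sym⇔ = mk⇔ E-sym E-sym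
      E-sim : ∀ i j c d → c ≤ K → d ≤ K → _
      E-sim Fin.zero Fin.zero = Similar.E-similar self-similar Fin.zero Fin.zero
      E-sim Fin.zero (Fin.suc j) c d = link-similar j c d
      E-sim (Fin.suc i) Fin.zero c d c≤ d≤ = ⇔-via E-sym⇔ (link-similar i d c d≤ c≤) E-sym⇔
      E-sim (Fin.suc i) (Fin.suc j) = Similar.E-similar sim i j
      init-sim : ∀ i c k → c ≤ K → k ≤ K → _
      init-sim Fin.zero = Similar.init-similar self-similar Fin.zero
      init-sim (Fin.suc i) = Similar.init-similar sim i
      fin-sim : ∀ i c k → c ≤ K → k ≤ K → _
      fin-sim Fin.zero = Similar.fin-similar self-similar Fin.zero
      fin-sim (Fin.suc i) = Similar.fin-similar sim i

    anchored-extends : ∀ {ȳ ȳ' x} → Similar K₃ ȳ ȳ' → ∀ a → Anchor a x → Extends ȳ ȳ' x x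
    anchored-extends sim a p = record { self-similar = Similar-refl ; link-similar = link a p }
      where
      open Similar sim
      link : ∀ a {x} → Anchor a x → ∀ j c d → c ≤ K → d ≤ K → _
      link (inj₁ m) p j c d c≤ d≤ =
        ⇔-via (E⇔CfinMinus _ q) (fin-similar j d (toℕ m ∸ c) (≤-trans d≤ K≤K₃) m∸c≤K₃) (E⇔CfinMinus _ q)
        where
        q = CfinMinus-iter (toℕ m) c p
        m∸c≤K₃ : toℕ m ∸ c ≤ K₃
        m∸c≤K₃ = ≤-trans (m∸n≤m (toℕ m) c) (≤-trans (toℕ≤pred[n] m) K₂≤K₃)
      link (inj₂ i) p j c d c≤ d≤ =
        ⇔-via (E⇔CinitPlus (c + toℕ i) q)
              (init-similar j d (c + toℕ i) (≤-trans d≤ K≤K₃) (+-mono-≤ c≤ (toℕ≤pred[n] i)))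
              (E⇔CinitPlus (c + toℕ i) q)
        where
        q = CinitPlus-iter c p

    linked-extends : ∀ {ȳ ȳ' x} → Similar K₃ ȳ ȳ' → ∀ i e → e ≤ K → E x (f^ e (ȳ i)) →
                     Extends ȳ ȳ' x (f^ e (ȳ' i))
    linked-extends {ȳ} {ȳ'} {x} sim i e e≤ p = record
      { self-similar = record
        { E-similar = λ _ _ c d c≤ d≤ →
            ⇔-via (E-cong (near c) (near d))
                  (E-similar i i (c + e) (d + e) (lift c≤) (lift d≤))
                  (E-cong (near' c) (near' d))
        ; init-similar = λ _ c k c≤ k≤ →
            ⇔-via (CinitPlus-cong k (near c)) (init-similar i (c + e) k (lift c≤) (wk k≤)) (CinitPlus-cong k (near' c))
        ; fin-similar = λ _ c k c≤ k≤ →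
            ⇔-via (CfinMinus-cong k (near c)) (fin-similar i (c + e) k (lift c≤) (wk k≤)) (CfinMinus-cong k (near' c))
        }
      ; link-similar = λ j c d c≤ d≤ →
          ⇔-via (E-cong (near c) E-refl) (E-similar i j (c + e) d (lift c≤) (wk d≤)) (E-cong (near' c) E-refl)
      }
      where
      open Similar sim
      near : ∀ c → E (f^ c x) (f^ (c + e) (ȳ i))
      near c = E-trans (E-iter c p) (E-reflexive (sym (iter-+ f c e (ȳ i))))
      near' : ∀ c → E (f^ c (f^ e (ȳ' i))) (f^ (c + e) (ȳ' i))
      near' c = E-reflexive (sym (iter-+ f c e (ȳ' i)))
      wk : ∀ {c} → c ≤ K → c ≤ K₃
      wk c≤ = ≤-trans c≤ K≤K₃
      lift : ∀ {c} → c ≤ K → c + e ≤ K₃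
      lift c≤ = ≤-trans (+-mono-≤ c≤ e≤) K₂≤K₃

    pullback-link : ∀ {ȳ ȳ' : Fin n → A} {x x' i} a → Similar K₃ ȳ ȳ' → a ≤ K →
                    ¬ Cfin (f^ a x) → ¬ Cfin (f^ a x') → E (f^ a x) (ȳ i) → E (f^ a x') (ȳ' i) →
                    ∀ j c d → c ≤ K → d ≤ K → E (f^ c x) (f^ d (ȳ j)) ⇔ E (f^ c x') (f^ d (ȳ' j))
    pullback-link {i = i} a sim a≤ ¬fin ¬fin' p p' j c d c≤ d≤ with order c a
    ... | below c s =
      ⇔-via (E-iter-below c s d ¬fin p)
            (E-similar i j 0 (s + d) z≤n (≤-trans (+-mono-≤ (m+n≤o⇒n≤o c a≤) d≤) K₂≤K₃))
            (E-iter-below c s d ¬fin' p')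
      where open Similar sim
    ... | above a s =
      ⇔-via (E-iter-above a (suc s) p)
            (E-similar i j (suc s) d (≤-trans (m+n≤o⇒n≤o a c≤) K≤K₃) (≤-trans d≤ K≤K₃))
            (E-iter-above a (suc s) p')
      where open Similar sim

    pullback-exists : ∀ {ȳ ȳ' : Fin n → A} {x i a} → Similar K₃ ȳ ȳ' → Free x → a ≤ K →
                      E (f^ a x) (ȳ i) → Σ A λ x' → f^ a x' ≡ ȳ' i
    pullback-exists {i = i} {a} sim free a≤ p = preimage-iter a λ m m<a q →
      Free-¬CinitPlus free (≤-trans a≤ K≤K₂) (≤-trans (<⇒≤ m<a) (≤-trans a≤ K≤K₂))
        (CinitPlus-resp m (from (Similar.init-similar sim i 0 m z≤n (≤-trans (<⇒≤ m<a) (≤-trans a≤ K≤K₃))) q)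
          (E-sym p))

    pullback-Free : ∀ {ȳ ȳ' : Fin n → A} {x x' i a} → Similar K₃ ȳ ȳ' → Free x → a ≤ K →
                    E (f^ a x) (ȳ i) → f^ a x' ≡ ȳ' i → Free x'
    pullback-Free {ȳ} {ȳ'} {x} {x'} {i} {a} sim free a≤ p eq = record { no-fin = no-fin ; no-init = no-init }
      where
      open Similar sim
      a≤K₂ : a ≤ K₂
      a≤K₂ = ≤-trans a≤ K≤K₂

      no-fin : ¬ Cfin (f^ K₂ x')
      no-fin q = Free.no-fin free (subst Cfin (sym (iter-split f x a≤K₂)) (Cfin-resp fin-y (E-iter s (E-sym p))))
        where
        s = K₂ ∸ a
        fin-y : Cfin (f^ s (ȳ i))
        fin-y = from (fin-similar i s 0 (≤-trans (m∸n≤m K₂ a) K₂≤K₃) z≤n)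
                  (subst Cfin (trans (iter-split f x' a≤K₂) (cong (f^ s) eq)) q)

      no-init : ∀ j → j ≤ K₂ → ¬ CinitPlus j x'
      no-init j j≤ q with CinitPlus-cancel a (a + j) (Free-¬Cfin free a≤K₂) init-x
        where
        init-x : CinitPlus (a + j) (f^ a x)
        init-x = CinitPlus-resp (a + j)
                   (from (init-similar i 0 (a + j) z≤n (+-mono-≤ a≤ j≤))
                     (subst (CinitPlus (a + j)) eq (CinitPlus-iter a q)))
                   (E-sym p)
      ... | r , a+j≡a+r , init =
        Free.no-init free j j≤ (subst (λ k → CinitPlus k x) (sym (+-cancelˡ-≡ a j r a+j≡a+r)) init)

    pullback-extends : ∀ {ȳ ȳ' x x' i a} → Similar K₃ ȳ ȳ' → Free x → a ≤ K →
                       E (f^ a x) (ȳ i) → f^ a x' ≡ ȳ' i → Extends ȳ ȳ' x x'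
    pullback-extends {ȳ' = ȳ'} {i = i} {a} sim free a≤ p eq = record
      { self-similar = free-similar free (pullback-Free sim free a≤ p eq)
      ; link-similar = pullback-link a sim a≤ ¬fin (¬fin-y' ∘ subst Cfin eq) p (E-reflexive eq)
      }
      where
      ¬fin : ¬ Cfin (f^ a _)
      ¬fin = Free-¬Cfin free (≤-trans a≤ K≤K₂)
      ¬fin-y' : ¬ Cfin (ȳ' i)
      ¬fin-y' q = ¬fin (Cfin-resp (from (Similar.fin-similar sim i 0 0 z≤n z≤n) q) (E-sym p))

    generic-extends : ∀ {ȳ ȳ' x x'} → Free x → (∀ l → ¬ Link ȳ l x) → Free x' → (∀ l → ¬ Link ȳ' l x') →
                      Extends ȳ ȳ' x x'
    generic-extends free ¬link free' ¬link' = record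
      { self-similar = free-similar free free'
      ; link-similar = λ j c d c≤ d≤ →
          false⇔false (unlinked⇒¬E free ¬link j c d c≤ d≤) (unlinked⇒¬E free' ¬link' j c d c≤ d≤)
      }

    Exceptional : (Fin n → A) → AnchorIx ⊎ LinkIx → A → Set
    Exceptional ȳ (inj₁ a) = Anchor a
    Exceptional ȳ (inj₂ l) = Link ȳ l

    Exceptional-unique : ∀ ȳ e {v w} → Exceptional ȳ e v → Exceptional ȳ e w → E v w
    Exceptional-unique ȳ (inj₁ (inj₁ m)) = CfinMinus-E (toℕ m)
    Exceptional-unique ȳ (inj₁ (inj₂ j)) = CinitPlus-E (toℕ j)
    Exceptional-unique ȳ (inj₂ (inj₁ _)) p q = E-trans p (E-sym q)
    Exceptional-unique ȳ (inj₂ (inj₂ (_ , r))) (p , ¬fin) (q , _) =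
      E-cancel-iter (suc (toℕ r)) ¬fin (E-trans p (E-sym q))

    exceptional-code : (AnchorIx ⊎ LinkIx) ↣ Fin ((suc K₂ + suc K₂) + (n * suc K + n * K))
    exceptional-code = ↔⇒↣ (↔-sym iso)
      where
      iso : Fin ((suc K₂ + suc K₂) + (n * suc K + n * K)) ↔ (AnchorIx ⊎ LinkIx)
      iso = (+↔⊎ ⊎-↔ ((*↔× ⊎-↔ *↔×) ↔-∘ +↔⊎)) ↔-∘ +↔⊎

    generic-exists : ∀ ȳ → Σ A λ v → Free v × (∀ l → ¬ Link ȳ l v)
    generic-exists ȳ with avoid exceptional-code (Exceptional ȳ) (Exceptional-unique ȳ)
    ... | v , ¬exceptional = v , unanchored⇒Free (¬exceptional ∘ inj₁) , ¬exceptional ∘ inj₂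

    unanchored-extension : ∀ {ȳ ȳ' x} → Similar K₃ ȳ ȳ' → Free x → Σ A (Extends ȳ ȳ' x)
    unanchored-extension {ȳ} {ȳ'} {x} sim free with lem {Σ LinkIx λ l → Link ȳ l x}
    ... | yes (inj₁ (i , e) , p) = f^ (toℕ e) (ȳ' i) , linked-extends sim i (toℕ e) (toℕ≤pred[n] e) p
    ... | yes (inj₂ (i , r) , p , _) with pullback-exists sim free (toℕ<n r) p
    ...   | x' , eq = x' , pullback-extends sim free (toℕ<n r) p eq
    unanchored-extension {ȳ} {ȳ'} sim free | no ¬link with generic-exists ȳ'
    ... | v , free' , ¬link' = v , generic-extends free (λ l q → ¬link (l , q)) free' ¬link'

    extension : ∀ {ȳ ȳ'} → Similar K₃ ȳ ȳ' → ∀ x → Σ A (Extends ȳ ȳ' x)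
    extension sim x with lem {Σ AnchorIx λ a → Anchor a x}
    ... | yes (a , p) = x , anchored-extends sim a p
    ... | no ¬anchor = unanchored-extension sim (unanchored⇒Free λ a q → ¬anchor (a , q))

    SatEx-invariant : ∀ {Φ ȳ ȳ'} → EqFree Φ → bound Φ ≤ K →
                      Similar K₃ ȳ ȳ' → SatEx M ȳ Φ → SatEx M ȳ' Φ
    SatEx-invariant ef b sim (x , s) with extension sim x
    ... | x' , ext = x' , to (similar-Sat (extend-similar (Similar-mono K≤K₃ sim) ext) ef b) s

lemma4p14 : ExcludedMiddle 0ℓ → (M : Str) → IsModelT M →
    (n : ℕ) (Φ : QF (suc n)) → EqFree Φ →
    Σ (QF n) λ θ → (ȳ : Fin n → Str.A M) → SatEx M ȳ Φ ⇔ Sat M ȳ θ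
lemma4p14 lem M mod n Φ ef =
  decisionTree lem (atoms n K₃) Q ,
  decisionTree-correct lem (atoms n K₃) Q λ agree → SatEx-invariant ef ≤-refl (agree⇒similar agree)
  where
  open Definability M n
  open Similarity M
  open Model lem M mod
  open Extension n (bound Φ)
  Q : (Fin n → Str.A M) → Set
  Q ȳ = SatEx M ȳ Φ
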